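{- If $k\geq 7$ is odd and $k\leq n\leq 3(k-1)/2$, then there is a $C_{k-2}$-free graph on $n$ vertices which contains more $k$-cycles than the balanced blow-up of a $k$-cycle on $n$ vertices.
   Context: $C_m$ denotes the cycle of length $m$; the number of $k$-cycles of a graph is the number of its subgraphs isomorphic to $C_k$. A balanced blow-up of $C_k$ on $n$ vertices is obtained by replacing the vertices of $C_k$ by independent sets whose sizes sum to $n$ and differ by at most one, and each edge by the complete bipartite graph between the corresponding sets. -}

module Defs where

open import Data.Bool using (Bool; true; false; _∧_)
open import Data.Nat using (ℕ; zero; suc; _+_; _*_; _≡ᵇ_)
open import Data.Nat.DivMod using (_mod_; _/_; _%_)
open import Data.Fin using (Fin; toℕ; _≟_)
open import Data.List using (List; []; _∷_; map; concatMap; allFin; length; filterᵇ; foldr)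
open import Data.Product using (Σ; _×_)
open import Data.Empty using (⊥)
open import Relation.Nullary using (¬_; does)
open import Relation.Binary.PropositionalEquality using (_≡_)
open import Function.Definitions using (Injective)

record Graph (n : ℕ) : Set where
  field
    adj    : Fin n → Fin n → Bool
    sym    : ∀ u v → adj u v ≡ adj v u
    irrefl : ∀ v → adj v v ≡ false
open Graph public

next : ∀ {ℓ} → Fin ℓ → Fin ℓ
next {suc m} i = suc (toℕ i) mod (suc m)

IsCycleMap : ∀ {n ℓ} → Graph n → (Fin ℓ → Fin n) → Set
IsCycleMap {n} {ℓ} G f = Injective _≡_ _≡_ f × (∀ i → adj G (f i) (f (next i)) ≡ true)

ContainsCycle : ∀ {n} → Graph n → ℕ → Set
ContainsCycle {n} G ℓ = Σ (Fin ℓ → Fin n) (IsCycleMap G)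

CycleFree : ∀ {n} → Graph n → ℕ → Set
CycleFree G ℓ = ¬ ContainsCycle G ℓ

allᵇ : ∀ {A : Set} → (A → Bool) → List A → Bool
allᵇ p = foldr (λ x b → p x ∧ b) true

allFuns : (k n : ℕ) → List (Fin k → Fin n)
allFuns zero n = (λ ()) ∷ []
allFuns (suc k) n = concatMap (λ f → map (λ x → cons x f) (allFin n)) (allFuns k n)
  where
  cons : Fin n → (Fin k → Fin n) → Fin (suc k) → Fin n
  cons x f Fin.zero = x
  cons x f (Fin.suc i) = f i

Rel : ℕ → Set
Rel n = Fin n → Fin n → Bool

isCycleMapᵇ : ∀ {n ℓ} → Rel n → (Fin ℓ → Fin n) → Bool
isCycleMapᵇ {n} {ℓ} A f =
  allᵇ (λ i → allᵇ (λ j → does (i ≟ j) Data.Bool.∨ Data.Bool.not (does (f i ≟ f j))) (allFin ℓ)) (allFin ℓ)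
  ∧ allᵇ (λ i → A (f i) (f (next i))) (allFin ℓ)

labelledCycles : ∀ {n} → Rel n → ℕ → ℕ
labelledCycles {n} A ℓ = length (filterᵇ (isCycleMapᵇ A) (allFuns ℓ n))

-- number of subgraphs isomorphic to C_ℓ (for ℓ ≥ 3): each such subgraph
-- corresponds to exactly 2ℓ labelled cycle maps (ℓ rotations × 2 directions)
numCyclesRel : ∀ {n} → Rel n → ℕ → ℕ
numCyclesRel A zero = 0
numCyclesRel A (suc m) = labelledCycles A (suc m) / (2 * suc m)

numCycles : ∀ {n} → Graph n → ℕ → ℕ
numCycles G ℓ = numCyclesRel (adj G) ℓ

-- balanced blow-up of C_k on n vertices: vertex v lies in part (v mod k);
-- parts have sizes summing to n differing by at most one; u ~ v iff their
-- parts are consecutive on the k-cycle.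
part : ∀ {n} (k : ℕ) → Fin n → ℕ
part zero v = 0
part (suc m) v = toℕ v % suc m

blowupAdj : ∀ {n} (k : ℕ) → Fin n → Fin n → Bool
blowupAdj zero u v = false
blowupAdj (suc m) u v =
  ((suc (part (suc m) u) % suc m) ≡ᵇ part (suc m) v)
  Data.Bool.∨ ((suc (part (suc m) v) % suc m) ≡ᵇ part (suc m) u)

blowupCycles : (k n : ℕ) → ℕ
blowupCycles k n = numCyclesRel (blowupAdj {n} k) k

{-# OPTIONS --safe #-}
-- Write k = 7 + j (j is even since k is odd) and give the vertices in part p of the blow-up the level
-- k − 1 − p. G adds to the blow-up all edges between levels 3 and 1 and between levels 2 and 0.
-- Visiting levels 2 and 1 in swapped order turns the natural k-cycle into a k-cycle of G outside the
-- blow-up, and its 2k labellings give G more k-cycles than the blow-up.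
-- Since n ≤ 3(k − 1)/2, levels 0, …, 4 are single vertices, so a (k − 2)-cycle of G meets each of them
-- at most once. It cannot use the edge 3 − 4: the distance to level 3 in the level graph without that
-- edge would drop by k − 2 along it and rise by at most one along each of the other k − 3 steps.
-- Otherwise the colourings by level ≥ 4 and by level ∈ {0, 4, 5, …} only change next to level 0, so
-- one of them is constant along the cycle. Then the cycle either stays within the four vertices of levels
-- ≤ 3, or avoids level 1 and hence the edge 1 − 2, the only edge joining levels at distances of equal
-- parity from level 3, which is impossible for a cycle of odd length k − 2.
module Submission where

open import Defs hiding (sym)
open import Data.Nat.Properties
open import Algebra.Properties.CommutativeSemigroup +-commutativeSemigroup using (xy∙z≈xz∙y)
open import Algebra.Properties.Semiring.Sum +-*-semiring
  using (sum; sum-cong-≗; ∑-distrib-+; sum-init-last; sum-remove; sum-replicate-zero; *-distribˡ-sum)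
open import Data.Bool using (Bool; true; false; _∧_; _∨_; not; _xor_; T; if_then_else_)
open import Data.Bool.Properties using (¬-not; T-≡; ∨-comm; ∨-zeroʳ)
open import Data.Empty using (⊥; ⊥-elim)
open import Data.Fin as Fin using (Fin; toℕ; fromℕ; fromℕ<; inject₁; punchIn) renaming (zero to fzero; suc to fsuc)
import Data.Fin.Properties as Finₚ
open import Data.List using ([]; _∷_; allFin; length; filterᵇ; lookup)
open import Data.List.Membership.Propositional using (_∈_)
open import Data.List.Membership.Propositional.Properties using (∈-allFin)
open import Data.List.Relation.Unary.Any as Any using (Any; here; there)
open import Data.List.Relation.Unary.Any.Properties using (map⁺; concatMap⁺; filter⁺; lookup-result; lookup-index)
open import Data.Nat as ℕ using (ℕ; zero; suc; _+_; _*_; _∸_; _≤_; _<_; z≤n; s≤s; _≡ᵇ_)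
open import Data.Nat.Divisibility using (_∣_; divides; ∣m+n∣m⇒∣n; ∣m∣n⇒∣m+n; m∣m*n; _∣0; ∣-refl)
open import Data.Nat.DivMod using (_%_; _/_; m/n≡1+[m∸n]/n; /-monoˡ-≤; m<n⇒m%n≡m; n%n≡0; m%n<n; [m+n]%n≡m%n)
open import Data.Nat.Tactic.RingSolver using (solve-∀)
open import Data.Product using (Σ; _×_; _,_; proj₁; proj₂; ∃)
open import Data.Sum using (_⊎_; inj₁; inj₂; [_,_]′)
open import Data.Sum.Properties using (inj₁-injective)
open import Function using (_∘_; id; _⇔_; mk⇔; Equivalence)
open import Function.Definitions using (Injective)
open import Relation.Binary.PropositionalEquality
open import Relation.Nullary using (¬_; does; yes; no)
open import Relation.Nullary.Decidable using (T?)

≡ᵇ-true⇒≡ : ∀ {a b} → (a ≡ᵇ b) ≡ true → a ≡ b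
≡ᵇ-true⇒≡ {a} {b} eq = ≡ᵇ⇒≡ a b (subst T (sym eq) _)

≢⇒≡ᵇ-false : ∀ {a b} → a ≢ b → (a ≡ᵇ b) ≡ false
≢⇒≡ᵇ-false {a} {b} a≢b with a ≡ᵇ b in eq
... | true  = ⊥-elim (a≢b (≡ᵇ-true⇒≡ eq))
... | false = refl

≡ᵇ-refl : ∀ a → (a ≡ᵇ a) ≡ true
≡ᵇ-refl zero    = refl
≡ᵇ-refl (suc a) = ≡ᵇ-refl a

isOdd : ℕ → Bool
isOdd zero    = false
isOdd (suc a) = not (isOdd a)

isOdd-even : ∀ {a} → 2 ∣ a → isOdd a ≡ false
isOdd-even (divides t refl) = isOdd-*2 t
  where
  isOdd-*2 : ∀ t → isOdd (t * 2) ≡ false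
  isOdd-*2 zero = refl
  isOdd-*2 (suc t) rewrite isOdd-*2 t = refl

m+o≤n⇒m/o<n/o : ∀ {m n o} .{{_ : ℕ.NonZero o}} → m + o ≤ n → m / o < n / o
m+o≤n⇒m/o<n/o {m} {n} {o} m+o≤n = begin-strict
  m / o                  <⟨ n<1+n (m / o) ⟩
  suc (m / o)            ≡⟨ cong (λ x → suc (x / o)) (m+n∸n≡m m o) ⟨
  suc ((m + o ∸ o) / o)  ≡⟨ m/n≡1+[m∸n]/n (m≤n+m o m) ⟨
  (m + o) / o            ≤⟨ /-monoˡ-≤ o m+o≤n ⟩
  n / o                  ∎
  where open ≤-Reasoning

odd⇒pred-even : ∀ m → ¬ 2 ∣ suc m → 2 ∣ m
odd⇒pred-even zero          _   = 2 ∣0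
odd⇒pred-even (suc zero)    odd = ⊥-elim (odd ∣-refl)
odd⇒pred-even (suc (suc m)) odd = ∣m∣n⇒∣m+n ∣-refl (odd⇒pred-even m (odd ∘ ∣m∣n⇒∣m+n ∣-refl))

true≢false : true ≢ false
true≢false ()

indicator : Bool → ℕ
indicator true  = 1
indicator false = 0

indicator-xor : ∀ a b → 2 * indicator (a ∧ b) + indicator (a xor b) ≡ indicator a + indicator b
indicator-xor true  true  = refl
indicator-xor true  false = refl
indicator-xor false true  = refl
indicator-xor false false = refl

indicator-xor≡0 : ∀ {a b} → indicator (a xor b) ≡ 0 → a ≡ b
indicator-xor≡0 {true}  {true}  _ = refl
indicator-xor≡0 {false} {false} _ = refl

even+even≤2 : ∀ {a b} → 2 ∣ a → 2 ∣ b → a + b ≤ 2 → a ≡ 0 ⊎ b ≡ 0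
even+even≤2 (divides zero a≡0) _ _ = inj₁ a≡0
even+even≤2 _ (divides zero b≡0) _ = inj₂ b≡0
even+even≤2 (divides (suc p) refl) (divides (suc q) refl) (s≤s (s≤s a+b≤0))
  with () ← m+n≡0⇒n≡0 (p * 2) (n≤0⇒n≡0 a+b≤0)

sum-mono-≤ : ∀ {m} {f g : Fin m → ℕ} → (∀ i → f i ≤ g i) → sum f ≤ sum g
sum-mono-≤ {zero}  f≤g = z≤n
sum-mono-≤ {suc m} f≤g = +-mono-≤ (f≤g fzero) (sum-mono-≤ (f≤g ∘ fsuc))

sum-ones : ∀ m → sum {m} (λ _ → 1) ≡ m
sum-ones zero    = refl
sum-ones (suc m) = cong suc (sum-ones m)

sum≡0⇒≡0 : ∀ {m} (f : Fin m → ℕ) → sum f ≡ 0 → ∀ i → f i ≡ 0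
sum≡0⇒≡0 f eq fzero    = m+n≡0⇒m≡0 (f fzero) eq
sum≡0⇒≡0 f eq (fsuc i) = sum≡0⇒≡0 (f ∘ fsuc) (m+n≡0⇒n≡0 (f fzero) eq) i

sum-indicator-≤1 : ∀ {m} (P : Fin m → Bool) → (∀ i i′ → P i ≡ true → P i′ ≡ true → i ≡ i′) →
                   sum (indicator ∘ P) ≤ 1
sum-indicator-≤1 {zero}  P unique = z≤n
sum-indicator-≤1 {suc m} P unique with P fzero in P0
... | true  = ≤-reflexive (cong suc (trans (sum-cong-≗ rest-false) (sum-replicate-zero m)))
  where
  rest-false : ∀ i → indicator (P (fsuc i)) ≡ 0
  rest-false i with P (fsuc i) in Pi
  ... | true with () ← unique fzero (fsuc i) P0 Pi
  ... | false = refl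
... | false = sum-indicator-≤1 (P ∘ fsuc) (λ i i′ p p′ → Finₚ.suc-injective (unique _ _ p p′))

sum-spike-≤ : ∀ {m} (f g : Fin (suc m) → ℕ) (i₀ : Fin (suc m)) {d} → sum f ≡ sum g →
              f i₀ + d ≤ g i₀ → (∀ i → i ≢ i₀ → f i ≤ suc (g i)) → d ≤ m
sum-spike-≤ {m} f g i₀ {d} eq spike elsewhere = +-cancelˡ-≤ (sum f) d m (begin
  sum f + d                                 ≡⟨ cong (_+ d) (sum-remove {i = i₀} f) ⟩
  f i₀ + sum (f ∘ punchIn i₀) + d           ≡⟨ xy∙z≈xz∙y (f i₀) _ d ⟩
  f i₀ + d + sum (f ∘ punchIn i₀)           ≤⟨ +-mono-≤ spike (sum-mono-≤ others) ⟩
  g i₀ + sum (λ i → 1 + g (punchIn i₀ i))   ≡⟨ cong (g i₀ +_) (∑-distrib-+ (λ _ → 1) (g ∘ punchIn i₀)) ⟩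
  g i₀ + (sum {m} (λ _ → 1) + sum (g ∘ punchIn i₀))
                                            ≡⟨ cong (λ x → g i₀ + (x + sum (g ∘ punchIn i₀))) (sum-ones m) ⟩
  g i₀ + (m + sum (g ∘ punchIn i₀))         ≡⟨ +-assoc (g i₀) m _ ⟨
  g i₀ + m + sum (g ∘ punchIn i₀)           ≡⟨ xy∙z≈xz∙y (g i₀) m _ ⟩
  g i₀ + sum (g ∘ punchIn i₀) + m           ≡⟨ cong (_+ m) (trans eq (sum-remove {i = i₀} g)) ⟨
  sum f + m                                 ∎)
  where
  open ≤-Reasoning
  others : ∀ i → f (punchIn i₀ i) ≤ 1 + g (punchIn i₀ i)
  others i = elsewhere (punchIn i₀ i) (Finₚ.punchInᵢ≢i i₀ i)

suc-%-cases : ∀ {m} a → a < suc m →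
  (suc a % suc m ≡ suc a × suc a < suc m) ⊎ (suc a % suc m ≡ 0 × suc a ≡ suc m)
suc-%-cases {m} a a<ℓ with suc a ℕ.<? suc m
... | yes a+1<ℓ = inj₁ (m<n⇒m%n≡m a+1<ℓ , a+1<ℓ)
... | no  a+1≮ℓ = inj₂ (trans (cong (_% suc m) a+1≡ℓ) (n%n≡0 (suc m)) , a+1≡ℓ)
  where
  a+1≡ℓ : suc a ≡ suc m
  a+1≡ℓ = ≤-antisym a<ℓ (≮⇒≥ a+1≮ℓ)

toℕ-next : ∀ {ℓ} (i : Fin ℓ) →
  (toℕ (next i) ≡ suc (toℕ i) × suc (toℕ i) < ℓ) ⊎ (toℕ (next i) ≡ 0 × suc (toℕ i) ≡ ℓ)
toℕ-next {suc m} i with suc-%-cases (toℕ i) (Finₚ.toℕ<n i)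
... | inj₁ (eq , i+1<ℓ) = inj₁ (trans (Finₚ.toℕ-fromℕ< _) eq , i+1<ℓ)
... | inj₂ (eq , i+1≡ℓ) = inj₂ (trans (Finₚ.toℕ-fromℕ< _) eq , i+1≡ℓ)

next-inject₁ : ∀ {m} (i : Fin m) → next (inject₁ i) ≡ fsuc i
next-inject₁ i with toℕ-next (inject₁ i)
... | inj₁ (eq , _)   = Finₚ.toℕ-injective (trans eq (cong suc (Finₚ.toℕ-inject₁ i)))
... | inj₂ (_ , i+1≡ℓ) =
  ⊥-elim (<-irrefl (suc-injective (trans (cong suc (sym (Finₚ.toℕ-inject₁ i))) i+1≡ℓ)) (Finₚ.toℕ<n i))

next-fromℕ : ∀ m → next (fromℕ m) ≡ fzero
next-fromℕ m with toℕ-next (fromℕ m)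
... | inj₁ (_ , m+1<ℓ) = ⊥-elim (<-irrefl (cong suc (Finₚ.toℕ-fromℕ m)) m+1<ℓ)
... | inj₂ (eq , _)    = Finₚ.toℕ-injective eq

next-injective : ∀ {ℓ} (i i′ : Fin ℓ) → next i ≡ next i′ → i ≡ i′
next-injective i i′ eq with toℕ-next i | toℕ-next i′
... | inj₁ (a , _) | inj₁ (b , _) = Finₚ.toℕ-injective (suc-injective (trans (sym a) (trans (cong toℕ eq) b)))
... | inj₂ (_ , a) | inj₂ (_ , b) = Finₚ.toℕ-injective (suc-injective (trans a (sym b)))
... | inj₁ (a , _) | inj₂ (b , _) with () ← trans (sym a) (trans (cong toℕ eq) b)
... | inj₂ (a , _) | inj₁ (b , _) with () ← trans (sym b) (trans (cong toℕ (sym eq)) a)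

prev : ∀ {m} → Fin (suc m) → Fin (suc m)
prev {m} fzero = fromℕ m
prev (fsuc i)  = inject₁ i

next-prev : ∀ {m} (i : Fin (suc m)) → next (prev i) ≡ i
next-prev {m} fzero = next-fromℕ m
next-prev (fsuc i)  = next-inject₁ i

sum-∘next : ∀ {m} (f : Fin (suc m) → ℕ) → sum (f ∘ next) ≡ sum f
sum-∘next {m} f = begin
  sum (f ∘ next)                          ≡⟨ sum-init-last (f ∘ next) ⟩
  sum (f ∘ next ∘ inject₁) + f (next (fromℕ m))
                                          ≡⟨ cong₂ _+_ (sum-cong-≗ (cong f ∘ next-inject₁)) (cong f (next-fromℕ m)) ⟩
  sum (f ∘ fsuc) + f fzero                ≡⟨ +-comm _ (f fzero) ⟩
  sum f                                   ∎
  where open ≡-Reasoning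

next∘next≢id : ∀ {m} (i : Fin (3 + m)) → next (next i) ≢ i
next∘next≢id i eq with toℕ-next i | toℕ-next (next i)
... | inj₁ (a , _) | inj₁ (b , _) = m≢1+n+m (toℕ i) (trans (sym (cong toℕ eq)) (trans b (cong suc a)))
... | inj₁ (a , _) | inj₂ (b , c) with () ← trans (cong (2 +_) (sym (trans (sym (cong toℕ eq)) b))) (trans (cong suc (sym a)) c)
... | inj₂ (a , c) | inj₁ (b , _) with () ← trans (cong suc (sym (trans (sym (cong toℕ eq)) (trans b (cong suc a))))) c
... | inj₂ (a , _) | inj₂ (_ , c) with () ← trans (cong suc (sym a)) c

next-opposite-next : ∀ {ℓ} (i : Fin ℓ) → next (Fin.opposite (next i)) ≡ Fin.opposite i
next-opposite-next {suc m} i with toℕ-next i | toℕ-next (Fin.opposite (next i))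
... | inj₁ (a , a<ℓ) | inj₁ (b , _) = Finₚ.toℕ-injective (begin
  toℕ (next (Fin.opposite (next i)))  ≡⟨ b ⟩
  suc (toℕ (Fin.opposite (next i)))   ≡⟨ cong suc (Finₚ.opposite-prop (next i)) ⟩
  suc (m ∸ toℕ (next i))              ≡⟨ cong (λ x → suc (m ∸ x)) a ⟩
  suc (m ∸ suc (toℕ i))               ≡⟨ +-∸-assoc 1 (≤-pred a<ℓ) ⟨
  m ∸ toℕ i                           ≡⟨ Finₚ.opposite-prop i ⟨
  toℕ (Fin.opposite i)                ∎)
  where open ≡-Reasoning
... | inj₁ (a , a<ℓ) | inj₂ (_ , c) = ⊥-elim (<-irrefl opp≡m (∸-monoʳ-< {m} {suc (toℕ i)} {0} (s≤s z≤n) (≤-pred a<ℓ)))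
  where
  opp≡m : m ∸ suc (toℕ i) ≡ m
  opp≡m = trans (cong (m ∸_) (sym a)) (trans (sym (Finₚ.opposite-prop (next i))) (suc-injective c))
... | inj₂ (a , _) | inj₁ (_ , b<ℓ) =
  ⊥-elim (<-irrefl (cong suc (trans (Finₚ.opposite-prop (next i)) (cong (m ∸_) a))) b<ℓ)
... | inj₂ (_ , c) | inj₂ (b , _) = Finₚ.toℕ-injective (begin
  toℕ (next (Fin.opposite (next i)))  ≡⟨ b ⟩
  0                                   ≡⟨ n∸n≡0 m ⟨
  m ∸ m                               ≡⟨ cong (m ∸_) (suc-injective c) ⟨
  m ∸ toℕ i                           ≡⟨ Finₚ.opposite-prop i ⟨
  toℕ (Fin.opposite i)                ∎)
  where open ≡-Reasoning

next^ : ∀ {ℓ} → ℕ → Fin ℓ → Fin ℓ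
next^ zero    i = i
next^ (suc a) i = next (next^ a i)

next^-next : ∀ {ℓ} a (i : Fin ℓ) → next^ a (next i) ≡ next (next^ a i)
next^-next zero    i = refl
next^-next (suc a) i = cong next (next^-next a i)

toℕ-next^ : ∀ {m} a → a < suc m → toℕ (next^ a (fzero {m})) ≡ a
toℕ-next^ zero    _   = refl
toℕ-next^ (suc a) a<ℓ with toℕ-next (next^ a fzero)
... | inj₁ (eq , _) = trans eq (cong suc (toℕ-next^ a (<-trans (n<1+n a) a<ℓ)))
... | inj₂ (_ , eq) = ⊥-elim (<-irrefl (trans (cong suc (sym (toℕ-next^ a (<-trans (n<1+n a) a<ℓ)))) eq) a<ℓ)

next^-toℕ : ∀ {m} (i : Fin (suc m)) → next^ (toℕ i) fzero ≡ i
next^-toℕ i = Finₚ.toℕ-injective (toℕ-next^ (toℕ i) (Finₚ.toℕ<n i))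

constant-along-next : ∀ {m} {A : Set} (χ : Fin (suc m) → A) → (∀ i → χ i ≡ χ (next i)) → ∀ i → χ i ≡ χ fzero
constant-along-next χ step i = trans (cong χ (sym (next^-toℕ i))) (from-zero (toℕ i))
  where
  from-zero : ∀ a → χ (next^ a fzero) ≡ χ fzero
  from-zero zero    = refl
  from-zero (suc a) = trans (sym (step (next^ a fzero))) (from-zero a)

∘next^-closed : ∀ {ℓ} {X : Set} (P : (Fin ℓ → X) → Set) → (∀ {f} → P f → P (f ∘ next)) →
                ∀ a {f} → P f → P (f ∘ next^ a)
∘next^-closed P closed zero    Pf = Pf
∘next^-closed P closed (suc a) Pf = ∘next^-closed P closed a (closed Pf)

opposite-injective : ∀ {ℓ} {i i′ : Fin ℓ} → Fin.opposite i ≡ Fin.opposite i′ → i ≡ i′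
opposite-injective {i = i} {i′} eq =
  trans (sym (Finₚ.opposite-involutive i)) (trans (cong Fin.opposite eq) (Finₚ.opposite-involutive i′))

dihedral : ∀ {ℓ} → Fin ℓ ⊎ Fin ℓ → Fin ℓ → Fin ℓ
dihedral (inj₁ d) i = next^ (toℕ d) i
dihedral (inj₂ d) i = Fin.opposite (next^ (toℕ d) i)

∘dihedral-closed : ∀ {ℓ} {X : Set} (P : (Fin ℓ → X) → Set) →
  (∀ {f} → P f → P (f ∘ next)) → (∀ {f} → P f → P (f ∘ Fin.opposite)) → ∀ x {f} → P f → P (f ∘ dihedral x)
∘dihedral-closed P rotate reflect (inj₁ d) Pf = ∘next^-closed P rotate (toℕ d) Pf
∘dihedral-closed P rotate reflect (inj₂ d) Pf = ∘next^-closed P rotate (toℕ d) (reflect Pf)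

-- A reflection traverses the edge 0 − 1 backwards.
rotation≢reflection : ∀ {m} (d e : Fin (3 + m)) → ¬ (dihedral (inj₁ d) ≗ dihedral (inj₂ e))
rotation≢reflection d e eq = next∘next≢id ρ (begin
  next (next ρ)                                     ≡⟨ cong next (trans (sym (next^-next (toℕ d) fzero)) (eq (next fzero))) ⟩
  next (Fin.opposite (next^ (toℕ e) (next fzero)))  ≡⟨ cong (next ∘ Fin.opposite) (next^-next (toℕ e) fzero) ⟩
  next (Fin.opposite (next ρ′))                     ≡⟨ next-opposite-next ρ′ ⟩
  Fin.opposite ρ′                                   ≡⟨ eq fzero ⟨
  ρ                                                 ∎)
  where
  open ≡-Reasoning
  ρ  = next^ (toℕ d) fzero
  ρ′ = next^ (toℕ e) fzero

dihedral-injective : ∀ {m} {x y : Fin (3 + m) ⊎ Fin (3 + m)} → dihedral x ≗ dihedral y → x ≡ y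
dihedral-injective {x = inj₁ d} {inj₁ d′} eq = cong inj₁ (Finₚ.toℕ-injective (begin
  toℕ d                        ≡⟨ toℕ-next^ (toℕ d) (Finₚ.toℕ<n d) ⟨
  toℕ (next^ (toℕ d) fzero)    ≡⟨ cong toℕ (eq fzero) ⟩
  toℕ (next^ (toℕ d′) fzero)   ≡⟨ toℕ-next^ (toℕ d′) (Finₚ.toℕ<n d′) ⟩
  toℕ d′                       ∎))
  where open ≡-Reasoning
dihedral-injective {x = inj₂ d} {inj₂ d′} eq =
  cong inj₂ (inj₁-injective (dihedral-injective {x = inj₁ d} {inj₁ d′} (opposite-injective ∘ eq)))
dihedral-injective {x = inj₁ d} {inj₂ e} eq = ⊥-elim (rotation≢reflection d e eq)
dihedral-injective {x = inj₂ e} {inj₁ d} eq = ⊥-elim (rotation≢reflection d e (sym ∘ eq))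

colour-changes-even : ∀ {m} (χ : Fin (suc m) → Bool) → 2 ∣ sum (λ i → indicator (χ i xor χ (next i)))
colour-changes-even χ = ∣m+n∣m⇒∣n (subst (2 ∣_) (sym total) (m∣m*n (sum χ₁))) (m∣m*n (sum both))
  where
  χ₁ = indicator ∘ χ
  both = λ i → indicator (χ i ∧ χ (next i))
  changes = λ i → indicator (χ i xor χ (next i))
  total : 2 * sum both + sum changes ≡ 2 * sum χ₁
  total = begin
    2 * sum both + sum changes                      ≡⟨ cong (_+ sum changes) (*-distribˡ-sum 2 both) ⟩
    sum (λ i → 2 * both i) + sum changes            ≡⟨ ∑-distrib-+ (λ i → 2 * both i) changes ⟨
    sum (λ i → 2 * both i + changes i)              ≡⟨ sum-cong-≗ (λ i → indicator-xor (χ i) (χ (next i))) ⟩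
    sum (λ i → χ₁ i + χ₁ (next i))                  ≡⟨ ∑-distrib-+ χ₁ (χ₁ ∘ next) ⟩
    sum χ₁ + sum (χ₁ ∘ next)                        ≡⟨ cong (sum χ₁ +_) (sum-∘next χ₁) ⟩
    sum χ₁ + sum χ₁                                 ≡⟨ cong (sum χ₁ +_) (+-identityʳ (sum χ₁)) ⟨
    2 * sum χ₁                                      ∎
    where open ≡-Reasoning

CycleMap : ∀ {n ℓ} → Rel n → (Fin ℓ → Fin n) → Set
CycleMap A f = Injective _≡_ _≡_ f × (∀ i → A (f i) (f (next i)) ≡ true)

MissesEdge : ∀ {n ℓ} → Rel n → (Fin ℓ → Fin n) → Set
MissesEdge A f = ∃ λ i → A (f i) (f (next i)) ≡ false

module _ {n m : ℕ} {A : Rel n} where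

  CycleMap-≗ : {f g : Fin m → Fin n} → f ≗ g → CycleMap A f → CycleMap A g
  CycleMap-≗ f≗g (inj , adj) = (λ e → inj (trans (f≗g _) (trans e (sym (f≗g _)))))
                              , (λ i → subst₂ (λ u v → A u v ≡ true) (f≗g i) (f≗g (next i)) (adj i))

  MissesEdge-≗ : {f g : Fin m → Fin n} → f ≗ g → MissesEdge A f → MissesEdge A g
  MissesEdge-≗ f≗g (i , missing) = i , subst₂ (λ u v → A u v ≡ false) (f≗g i) (f≗g (next i)) missing

module _ {n m : ℕ} {A : Rel n} {f : Fin (suc m) → Fin n} where

  CycleMap-∘next : CycleMap A f → CycleMap A (f ∘ next)
  CycleMap-∘next (inj , adj) = (λ e → next-injective _ _ (inj e)) , adj ∘ next

  MissesEdge-∘next : MissesEdge A f → MissesEdge A (f ∘ next)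
  MissesEdge-∘next (i , missing) = prev i , subst (λ z → A (f z) (f (next z)) ≡ false) (sym (next-prev i)) missing

  module _ (A-sym : ∀ u v → A u v ≡ A v u) where

    CycleMap-∘opposite : CycleMap A f → CycleMap A (f ∘ Fin.opposite)
    CycleMap-∘opposite (inj , adj) = (λ e → opposite-injective (inj e)) , adj′
      where
      adj′ : ∀ i → A (f (Fin.opposite i)) (f (Fin.opposite (next i))) ≡ true
      adj′ i = trans (A-sym _ _) (subst (λ z → A (f (Fin.opposite (next i))) (f z) ≡ true)
                                        (next-opposite-next i) (adj (Fin.opposite (next i))))

    MissesEdge-∘opposite : MissesEdge A f → MissesEdge A (f ∘ Fin.opposite)
    MissesEdge-∘opposite (i , missing) =
      Fin.opposite (next i) , trans (cong₂ (λ u v → A (f u) (f v)) opp-opp opp-next) (trans (A-sym _ _) missing)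
      where
      opp-opp : Fin.opposite (Fin.opposite (next i)) ≡ next i
      opp-opp = Finₚ.opposite-involutive (next i)
      opp-next : Fin.opposite (next (Fin.opposite (next i))) ≡ i
      opp-next = trans (cong Fin.opposite (next-opposite-next i)) (Finₚ.opposite-involutive i)

allᵇ-sound : ∀ {A : Set} (p : A → Bool) xs → allᵇ p xs ≡ true → ∀ {x} → x ∈ xs → p x ≡ true
allᵇ-sound p (y ∷ ys) all-p x∈ with p y in py
allᵇ-sound p (y ∷ ys) all-p (here refl) | true = py
allᵇ-sound p (y ∷ ys) all-p (there x∈)  | true = allᵇ-sound p ys all-p x∈

allᵇ-complete : ∀ {A : Set} (p : A → Bool) xs → (∀ {x} → x ∈ xs → p x ≡ true) → allᵇ p xs ≡ true
allᵇ-complete p []       _   = refl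
allᵇ-complete p (x ∷ xs) p-∈ rewrite p-∈ (here refl) = allᵇ-complete p xs (p-∈ ∘ there)

allᵇ-allFin : ∀ {ℓ} (p : Fin ℓ → Bool) → allᵇ p (allFin ℓ) ≡ true ⇔ (∀ i → p i ≡ true)
allᵇ-allFin p = mk⇔ (λ all-p i → allᵇ-sound p (allFin _) all-p (∈-allFin i))
                    (λ p-all → allᵇ-complete p (allFin _) (λ {i} _ → p-all i))

distinctᵇ-sound : ∀ {ℓ n} (f : Fin ℓ → Fin n) i j →
  (does (i Fin.≟ j) ∨ not (does (f i Fin.≟ f j))) ≡ true → f i ≡ f j → i ≡ j
distinctᵇ-sound f i j h fi≡fj with i Fin.≟ j
... | yes i≡j = i≡j
... | no  _ with f i Fin.≟ f j
... | no fi≢fj = ⊥-elim (fi≢fj fi≡fj)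

distinctᵇ-complete : ∀ {ℓ n} (f : Fin ℓ → Fin n) i j →
  (f i ≡ f j → i ≡ j) → (does (i Fin.≟ j) ∨ not (does (f i Fin.≟ f j))) ≡ true
distinctᵇ-complete f i j inj with i Fin.≟ j
... | yes _ = refl
... | no i≢j with f i Fin.≟ f j
... | yes fi≡fj = ⊥-elim (i≢j (inj fi≡fj))
... | no  _     = refl

module _ {n ℓ : ℕ} (A : Rel n) (f : Fin ℓ → Fin n) where
  open Equivalence

  isCycleMapᵇ-sound : isCycleMapᵇ A f ≡ true → CycleMap A f
  isCycleMapᵇ-sound h
    with allᵇ (λ i → allᵇ (λ j → does (i Fin.≟ j) ∨ not (does (f i Fin.≟ f j))) (allFin ℓ)) (allFin ℓ) in distinct
       | allᵇ (λ i → A (f i) (f (next i))) (allFin ℓ) in adjacent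
  ... | true | true = (λ {i} {j} → distinctᵇ-sound f i j (to (allᵇ-allFin _) (to (allᵇ-allFin _) distinct i) j))
                    , to (allᵇ-allFin _) adjacent

  isCycleMapᵇ-complete : CycleMap A f → isCycleMapᵇ A f ≡ true
  isCycleMapᵇ-complete (inj , adjacent) =
    cong₂ _∧_ (from (allᵇ-allFin _) (λ i → from (allᵇ-allFin _) (λ j → distinctᵇ-complete f i j inj)))
              (from (allᵇ-allFin _) adjacent)

CycleMap-mono : ∀ {n ℓ} {A A′ : Rel n} {f : Fin ℓ → Fin n} →
  (∀ u v → A u v ≡ true → A′ u v ≡ true) → CycleMap A f → CycleMap A′ f
CycleMap-mono A⊆A′ (inj , adj) = inj , λ i → A⊆A′ _ _ (adj i)

MissesEdge⇒isCycleMapᵇ-false : ∀ {n ℓ} {A : Rel n} {f : Fin ℓ → Fin n} → MissesEdge A f → isCycleMapᵇ A f ≡ false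
MissesEdge⇒isCycleMapᵇ-false {A = A} {f} (i , missing) = ¬-not λ cyc →
  true≢false (trans (sym (proj₂ (isCycleMapᵇ-sound A f cyc) i)) missing)

allFuns-complete : ∀ ℓ n (g : Fin ℓ → Fin n) → Any (_≗ g) (allFuns ℓ n)
allFuns-complete zero    n g = here (λ ())
allFuns-complete (suc ℓ) n g = concatMap⁺ _ (Any.map
  (λ h≗ → map⁺ (Any.map (λ { refl → λ { fzero → refl ; (fsuc i) → h≗ i } }) (∈-allFin (g fzero))))
  (allFuns-complete ℓ n (g ∘ fsuc)))

filterᵇ-Any : ∀ {A : Set} {P : A → Set} (r : A → Bool) {xs} →
              (∀ x → P x → r x ≡ true) → Any P xs → Any P (filterᵇ r xs)
filterᵇ-Any r r-P p =
  [ id , (λ ¬r → ⊥-elim (¬r (Equivalence.from T-≡ (r-P _ (lookup-result p))))) ]′ (filter⁺ (T? ∘ r) p)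

length-filterᵇ-split : ∀ {A : Set} (p q : A → Bool) → (∀ x → p x ≡ true → q x ≡ true) → ∀ xs →
  length (filterᵇ p xs) + length (filterᵇ (λ x → q x ∧ not (p x)) xs) ≡ length (filterᵇ q xs)
length-filterᵇ-split p q p⇒q [] = refl
length-filterᵇ-split p q p⇒q (x ∷ xs) with p x in px
... | true rewrite p⇒q x px = cong suc (length-filterᵇ-split p q p⇒q xs)
... | false with q x
...   | true  = trans (+-suc _ _) (cong suc (length-filterᵇ-split p q p⇒q xs))
...   | false = length-filterᵇ-split p q p⇒q xs

-- Each g i occurs in the filtered list up to ≗, and these occurrences have distinct positions.
distinct-maps-≤ : ∀ {ℓ n M} (r : (Fin ℓ → Fin n) → Bool) (g : Fin M → Fin ℓ → Fin n) →
  (∀ {i i′} → g i ≗ g i′ → i ≡ i′) → (∀ i h → h ≗ g i → r h ≡ true) →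
  M ≤ length (filterᵇ r (allFuns ℓ n))
distinct-maps-≤ {ℓ} {n} r g distinct r-g = Finₚ.injective⇒≤ index-injective
  where
  occurrence : ∀ i → Any (_≗ g i) (filterᵇ r (allFuns ℓ n))
  occurrence i = filterᵇ-Any r (r-g i) (allFuns-complete ℓ n (g i))
  index-injective : Injective _≡_ _≡_ (Any.index ∘ occurrence)
  index-injective {i} {i′} eq = distinct λ x → trans (sym (lookup-index (occurrence i) x))
    (trans (cong (λ pos → lookup (filterᵇ r (allFuns ℓ n)) pos x) eq) (lookup-index (occurrence i′) x))

-- The construction

-- The quotient of the construction on levels 0 … 6 + j: the cycle 0 − 1 − ⋯ − (6 + j) − 0 with the
-- chords 3 − 1 and 2 − 0.
module LevelGraph (j : ℕ) where

  data LevelStep : ℕ → ℕ → Set where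
    down    : ∀ a → a < 6 + j → LevelStep (suc a) a
    up      : ∀ a → a < 6 + j → LevelStep a (suc a)
    wrap    : LevelStep 0 (6 + j)
    wrap′   : LevelStep (6 + j) 0
    chord₃₁ : LevelStep 3 1
    chord₁₃ : LevelStep 1 3
    chord₂₀ : LevelStep 2 0
    chord₀₂ : LevelStep 0 2

  flip : ∀ {a b} → LevelStep a b → LevelStep b a
  flip (down a a<) = up a a<
  flip (up a a<)   = down a a<
  flip wrap        = wrap′
  flip wrap′       = wrap
  flip chord₃₁     = chord₁₃
  flip chord₁₃     = chord₃₁
  flip chord₂₀     = chord₀₂
  flip chord₀₂     = chord₂₀

  Step₃₄ : ℕ → ℕ → Set
  Step₃₄ a b = (a ≡ 4 × b ≡ 3) ⊎ (a ≡ 3 × b ≡ 4)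

  Step₁₂ : ℕ → ℕ → Set
  Step₁₂ a b = (a ≡ 2 × b ≡ 1) ⊎ (a ≡ 1 × b ≡ 2)

  -- Distance to level 3 in the level graph without the edge 3 − 4.
  potential : ℕ → ℕ
  potential 0 = 2
  potential 1 = 1
  potential 2 = 1
  potential 3 = 0
  potential (suc (suc (suc (suc a)))) = 5 + j ∸ a

  potential-top : potential (6 + j) ≡ 3
  potential-top = m+n∸n≡m 3 j

  potential-down : ∀ c → c < 2 + j → potential (4 + c) ≡ suc (potential (5 + c))
  potential-down c c< = +-∸-assoc 1 {4 + j} {c} (≤-trans (≤-pred c<) (m≤n+m (1 + j) 3))

  potential-1-Lipschitz : ∀ {a b} → LevelStep a b → ¬ Step₃₄ a b →
                          potential b ≤ suc (potential a) × potential a ≤ suc (potential b)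
  potential-1-Lipschitz (down 0 _) _ = s≤s (s≤s z≤n) , s≤s z≤n
  potential-1-Lipschitz (down 1 _) _ = s≤s z≤n , s≤s z≤n
  potential-1-Lipschitz (down 2 _) _ = s≤s z≤n , z≤n
  potential-1-Lipschitz (down 3 _) ¬34 = ⊥-elim (¬34 (inj₁ (refl , refl)))
  potential-1-Lipschitz (down (suc (suc (suc (suc c)))) (s≤s (s≤s (s≤s (s≤s c<))))) _ =
    ≤-reflexive eq , subst (λ x → potential (5 + c) ≤ suc x) (sym eq) (m≤n+m _ 2)
    where eq = potential-down c c<
  potential-1-Lipschitz (up 0 _) _ = s≤s z≤n , s≤s (s≤s z≤n)
  potential-1-Lipschitz (up 1 _) _ = s≤s z≤n , s≤s z≤n
  potential-1-Lipschitz (up 2 _) _ = z≤n , s≤s z≤n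
  potential-1-Lipschitz (up 3 _) ¬34 = ⊥-elim (¬34 (inj₂ (refl , refl)))
  potential-1-Lipschitz (up (suc (suc (suc (suc c)))) (s≤s (s≤s (s≤s (s≤s c<))))) _ =
    subst (λ x → potential (5 + c) ≤ suc x) (sym eq) (m≤n+m _ 2) , ≤-reflexive eq
    where eq = potential-down c c<
  potential-1-Lipschitz wrap  _ rewrite potential-top = ≤-refl , s≤s (s≤s z≤n)
  potential-1-Lipschitz wrap′ _ rewrite potential-top = s≤s (s≤s z≤n) , ≤-refl
  potential-1-Lipschitz chord₃₁ _ = s≤s z≤n , z≤n
  potential-1-Lipschitz chord₁₃ _ = z≤n , s≤s z≤n
  potential-1-Lipschitz chord₂₀ _ = s≤s (s≤s z≤n) , s≤s z≤n
  potential-1-Lipschitz chord₀₂ _ = s≤s z≤n , s≤s (s≤s z≤n)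

  parityColour : ℕ → Bool
  parityColour = isOdd ∘ potential

  parityColour-changes : 2 ∣ j → ∀ {a b} → LevelStep a b → ¬ Step₁₂ a b →
                         (parityColour a xor parityColour b) ≡ true
  parityColour-changes _ (down 0 _) _ = refl
  parityColour-changes _ (down 1 _) ¬12 = ⊥-elim (¬12 (inj₁ (refl , refl)))
  parityColour-changes _ (down 2 _) _ = refl
  parityColour-changes j-even (down 3 _) _ rewrite isOdd-even j-even = refl
  parityColour-changes _ (down (suc (suc (suc (suc c)))) (s≤s (s≤s (s≤s (s≤s c<))))) _
    rewrite potential-down c c< with parityColour (5 + c)
  ... | true  = refl
  ... | false = refl
  parityColour-changes _ (up 0 _) _ = refl
  parityColour-changes _ (up 1 _) ¬12 = ⊥-elim (¬12 (inj₂ (refl , refl)))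
  parityColour-changes _ (up 2 _) _ = refl
  parityColour-changes j-even (up 3 _) _ rewrite isOdd-even j-even = refl
  parityColour-changes _ (up (suc (suc (suc (suc c)))) (s≤s (s≤s (s≤s (s≤s c<))))) _
    rewrite potential-down c c< with parityColour (5 + c)
  ... | true  = refl
  ... | false = refl
  parityColour-changes _ wrap  _ rewrite potential-top = refl
  parityColour-changes _ wrap′ _ rewrite potential-top = refl
  parityColour-changes _ chord₃₁ _ = refl
  parityColour-changes _ chord₁₃ _ = refl
  parityColour-changes _ chord₂₀ _ = refl
  parityColour-changes _ chord₀₂ _ = refl

  aboveThree : ℕ → Bool
  aboveThree (suc (suc (suc (suc _)))) = true
  aboveThree _ = false

  zeroOrAboveThree : ℕ → Bool
  zeroOrAboveThree 0 = true
  zeroOrAboveThree a = aboveThree a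

  aboveThree-false⇒≤3 : ∀ a → aboveThree a ≡ false → a ≤ 3
  aboveThree-false⇒≤3 0 _ = z≤n
  aboveThree-false⇒≤3 1 _ = s≤s z≤n
  aboveThree-false⇒≤3 2 _ = s≤s (s≤s z≤n)
  aboveThree-false⇒≤3 3 _ = s≤s (s≤s (s≤s z≤n))

  zeroOrAboveThree-false⇒≤3 : ∀ a → zeroOrAboveThree a ≡ false → a ≤ 3
  zeroOrAboveThree-false⇒≤3 (suc a) = aboveThree-false⇒≤3 (suc a)

  colour-changes-≤-visits₀ : ∀ {a b} → LevelStep a b → ¬ Step₃₄ a b →
    indicator (aboveThree a xor aboveThree b) + indicator (zeroOrAboveThree a xor zeroOrAboveThree b)
      ≤ indicator (a ≡ᵇ 0) + indicator (b ≡ᵇ 0)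
  colour-changes-≤-visits₀ (down 0 _) _ = s≤s z≤n
  colour-changes-≤-visits₀ (down 1 _) _ = z≤n
  colour-changes-≤-visits₀ (down 2 _) _ = z≤n
  colour-changes-≤-visits₀ (down 3 _) ¬34 = ⊥-elim (¬34 (inj₁ (refl , refl)))
  colour-changes-≤-visits₀ (down (suc (suc (suc (suc _)))) _) _ = z≤n
  colour-changes-≤-visits₀ (up 0 _) _ = s≤s z≤n
  colour-changes-≤-visits₀ (up 1 _) _ = z≤n
  colour-changes-≤-visits₀ (up 2 _) _ = z≤n
  colour-changes-≤-visits₀ (up 3 _) ¬34 = ⊥-elim (¬34 (inj₂ (refl , refl)))
  colour-changes-≤-visits₀ (up (suc (suc (suc (suc _)))) _) _ = z≤n
  colour-changes-≤-visits₀ wrap    _ = s≤s z≤n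
  colour-changes-≤-visits₀ wrap′   _ = s≤s z≤n
  colour-changes-≤-visits₀ chord₃₁ _ = z≤n
  colour-changes-≤-visits₀ chord₁₃ _ = z≤n
  colour-changes-≤-visits₀ chord₂₀ _ = s≤s z≤n
  colour-changes-≤-visits₀ chord₀₂ _ = s≤s z≤n

module Construction (j n : ℕ) where
  open LevelGraph j public

  k : ℕ
  k = 7 + j

  level : Fin n → ℕ
  level v = 6 + j ∸ part k v

  part<k : ∀ (v : Fin n) → part k v < k
  part<k v = m%n<n (toℕ v) k

  chordᵇ : ℕ → ℕ → Bool
  chordᵇ a b = ((a ≡ᵇ 3) ∧ (b ≡ᵇ 1)) ∨ ((a ≡ᵇ 2) ∧ (b ≡ᵇ 0))

  chord : Rel n
  chord u v = chordᵇ (level u) (level v) ∨ chordᵇ (level v) (level u)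

  blowup : Rel n
  blowup = blowupAdj k

  Gadj : Rel n
  Gadj u v = blowup u v ∨ chord u v

  blowupAdj-sym : ∀ (u v : Fin n) → blowup u v ≡ blowup v u
  blowupAdj-sym u v = ∨-comm (suc (part k u) % k ≡ᵇ part k v) _

  Gadj-sym : ∀ u v → Gadj u v ≡ Gadj v u
  Gadj-sym u v = cong₂ _∨_ (blowupAdj-sym u v) (∨-comm (chordᵇ (level u) (level v)) _)

  chordᵇ-irrefl : ∀ a → chordᵇ a a ≡ false
  chordᵇ-irrefl 0 = refl
  chordᵇ-irrefl 1 = refl
  chordᵇ-irrefl 2 = refl
  chordᵇ-irrefl 3 = refl
  chordᵇ-irrefl (suc (suc (suc (suc _)))) = refl

  not-next-part : ∀ (v : Fin n) → (suc (part k v) % k ≡ᵇ part k v) ≡ false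
  not-next-part v = ≢⇒≡ᵇ-false next-part≢part
    where
    next-part≢part : suc (part k v) % k ≢ part k v
    next-part≢part with suc-%-cases (part k v) (part<k v)
    ... | inj₁ (eq , _)     = λ p → 1+n≢n (trans (sym eq) p)
    ... | inj₂ (eq , p+1≡k) = λ p → k≢1 (trans (sym p+1≡k) (cong suc (trans (sym p) eq)))
      where
      k≢1 : 7 + j ≢ 1
      k≢1 ()

  Gadj-irrefl : ∀ v → Gadj v v ≡ false
  Gadj-irrefl v = cong₂ _∨_ (cong₂ _∨_ (not-next-part v) (not-next-part v))
                            (cong₂ _∨_ (chordᵇ-irrefl (level v)) (chordᵇ-irrefl (level v)))

  G : Graph n
  G = record { adj = Gadj ; sym = Gadj-sym ; irrefl = Gadj-irrefl }

  chordᵇ⇒LevelStep : ∀ a b → chordᵇ a b ≡ true → LevelStep a b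
  chordᵇ⇒LevelStep 3 1 _ = chord₃₁
  chordᵇ⇒LevelStep 2 0 _ = chord₂₀
  chordᵇ⇒LevelStep 0 b ()
  chordᵇ⇒LevelStep 1 b ()
  chordᵇ⇒LevelStep 2 (suc b) ()
  chordᵇ⇒LevelStep 3 0 ()
  chordᵇ⇒LevelStep 3 (suc (suc b)) ()
  chordᵇ⇒LevelStep (suc (suc (suc (suc a)))) b ()

  next-part⇒LevelStep : ∀ u v → (suc (part k u) % k ≡ᵇ part k v) ≡ true → LevelStep (level u) (level v)
  next-part⇒LevelStep u v eq with suc-%-cases (part k u) (part<k u)
  ... | inj₁ (e , p+1<k) =
    subst₂ LevelStep (sym level-u) (sym level-v) (down (5 + j ∸ part k u) (s≤s (m∸n≤m (5 + j) (part k u))))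
    where
    level-u : level u ≡ suc (5 + j ∸ part k u)
    level-u = +-∸-assoc 1 (≤-pred p+1<k)
    level-v : level v ≡ 5 + j ∸ part k u
    level-v = cong (6 + j ∸_) (trans (sym (≡ᵇ-true⇒≡ eq)) e)
  ... | inj₂ (e , p+1≡k) = subst₂ LevelStep (sym level-u) (sym level-v) wrap
    where
    level-u : level u ≡ 0
    level-u = trans (cong (6 + j ∸_) (suc-injective p+1≡k)) (n∸n≡0 (6 + j))
    level-v : level v ≡ 6 + j
    level-v = cong (6 + j ∸_) (trans (sym (≡ᵇ-true⇒≡ eq)) e)

  Gadj⇒LevelStep : ∀ u v → Gadj u v ≡ true → LevelStep (level u) (level v)
  Gadj⇒LevelStep u v uv with suc (part k u) % k ≡ᵇ part k v in e₁
  ... | true = next-part⇒LevelStep u v e₁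
  ... | false with suc (part k v) % k ≡ᵇ part k u in e₂
  ...   | true = flip (next-part⇒LevelStep v u e₂)
  ...   | false with chordᵇ (level u) (level v) in e₃
  ...     | true  = chordᵇ⇒LevelStep _ _ e₃
  ...     | false = flip (chordᵇ⇒LevelStep _ _ uv)

-- No (k − 2)-cycles

module CycleFreeness (j n : ℕ) (n≤ : n ≤ 9 + 2 * j) (j-even : 2 ∣ j) where
  open Construction j n

  -- Since n ≤ k + (2 + j), vertices beyond k only lie in parts below 2 + j.
  high-part⇒toℕ≡part : ∀ v → 2 + j ≤ part k v → toℕ v ≡ part k v
  high-part⇒toℕ≡part v 2+j≤p with toℕ v ℕ.<? k
  ... | yes v<k = sym (m<n⇒m%n≡m v<k)
  ... | no  v≮k = ⊥-elim (<⇒≱ x<2+j (subst (2 + j ≤_) p≡x 2+j≤p))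
    where
    x = toℕ v ∸ k
    v≡x+k : toℕ v ≡ x + k
    v≡x+k = sym (m∸n+n≡m (≮⇒≥ v≮k))
    n≡ : 9 + 2 * j ≡ 2 + j + k
    n≡ = solve j
      where
      solve : ∀ j → 9 + 2 * j ≡ 2 + j + (7 + j)
      solve = solve-∀
    x<2+j : x < 2 + j
    x<2+j = +-cancelʳ-< k x (2 + j)
      (subst (_< 2 + j + k) v≡x+k (<-≤-trans (Finₚ.toℕ<n v) (≤-trans n≤ (≤-reflexive n≡))))
    p≡x : part k v ≡ x
    p≡x = trans (cong (_% k) v≡x+k) (trans ([m+n]%n≡m%n x k) (m<n⇒m%n≡m (<-≤-trans x<2+j (m≤n+m (2 + j) 5))))

  level-injective : ∀ u v → level u ≡ level v → level u ≤ 4 → u ≡ v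
  level-injective u v lu≡lv lu≤4 = Finₚ.toℕ-injective (begin
    toℕ u    ≡⟨ high-part⇒toℕ≡part u (high-part u lu≤4) ⟩
    part k u ≡⟨ ∸-cancelˡ-≡ (≤-pred (part<k u)) (≤-pred (part<k v)) lu≡lv ⟩
    part k v ≡⟨ high-part⇒toℕ≡part v (high-part v (subst (_≤ 4) lu≡lv lu≤4)) ⟨
    toℕ v    ∎)
    where
    open ≡-Reasoning
    high-part : ∀ w → level w ≤ 4 → 2 + j ≤ part k w
    high-part w lw≤4 = +-cancelˡ-≤ 4 (2 + j) (part k w)
      (≤-trans (m≤n+m∸n (6 + j) (part k w)) (≤-trans (+-monoʳ-≤ (part k w) lw≤4) (≤-reflexive (+-comm (part k w) 4))))

  module ShortCycle (f : Fin (5 + j) → Fin n) (f-inj : Injective _≡_ _≡_ f)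
                    (f-adj : ∀ i → Gadj (f i) (f (next i)) ≡ true) where

    L : Fin (5 + j) → ℕ
    L = level ∘ f

    step : ∀ i → LevelStep (L i) (L (next i))
    step i = Gadj⇒LevelStep (f i) (f (next i)) (f-adj i)

    L-injective : ∀ i i′ → L i ≡ L i′ → L i ≤ 4 → i ≡ i′
    L-injective i i′ eq L≤4 = f-inj (level-injective _ _ eq L≤4)

    not-within-levels≤3 : ¬ (∀ i → L i ≤ 3)
    not-within-levels≤3 L≤3 with Finₚ.pigeonhole (s≤s (s≤s (s≤s (s≤s (s≤s z≤n))))) (λ i → fromℕ< (s≤s (L≤3 i)))
    ... | i , i′ , i<i′ , eq = <-irrefl (cong toℕ (L-injective i i′ L≡ (≤-trans (L≤3 i) (n≤1+n 3)))) i<i′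
      where
      L≡ : L i ≡ L i′
      L≡ = trans (sym (Finₚ.toℕ-fromℕ< _)) (trans (cong toℕ eq) (Finₚ.toℕ-fromℕ< _))

    -- The cycle has odd length, so it uses the edge 1 − 2.
    visits-level-1 : ¬ (∀ i → L i ≢ 1)
    visits-level-1 avoids-1 = 5+j-odd (subst (2 ∣_) (trans (sum-cong-≗ all-change) (sum-ones (5 + j)))
                                                    (colour-changes-even (parityColour ∘ L)))
      where
      5+j-odd : ¬ 2 ∣ 5 + j
      5+j-odd 2∣5+j with isOdd-even 2∣5+j
      ... | odd≡false rewrite isOdd-even j-even with () ← odd≡false
      all-change : ∀ i → indicator (parityColour (L i) xor parityColour (L (next i))) ≡ 1
      all-change i = cong indicator (parityColour-changes j-even (step i) ¬12)
        where
        ¬12 : ¬ Step₁₂ (L i) (L (next i))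
        ¬12 (inj₁ (_ , L≡1)) = avoids-1 (next i) L≡1
        ¬12 (inj₂ (L≡1 , _)) = avoids-1 i L≡1

    step₃₄-unique : ∀ i₀ → Step₃₄ (L i₀) (L (next i₀)) → ∀ i → i ≢ i₀ → ¬ Step₃₄ (L i) (L (next i))
    step₃₄-unique i₀ s₀ i i≢i₀ s with s₀ | s
    ... | inj₁ (a , _) | inj₁ (a′ , _) = i≢i₀ (L-injective i i₀ (trans a′ (sym a)) (≤-reflexive a′))
    ... | inj₂ (a , _) | inj₂ (a′ , _) = i≢i₀ (L-injective i i₀ (trans a′ (sym a)) (≤-trans (≤-reflexive a′) (n≤1+n 3)))
    ... | inj₁ (a , b) | inj₂ (a′ , b′) = next∘next≢id i₀ (trans (cong next (sym i≡)) next-i≡)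
      where
      i≡ = L-injective i (next i₀) (trans a′ (sym b)) (≤-trans (≤-reflexive a′) (n≤1+n 3))
      next-i≡ = L-injective (next i) i₀ (trans b′ (sym a)) (≤-reflexive b′)
    ... | inj₂ (a , b) | inj₁ (a′ , b′) = next∘next≢id i₀ (trans (cong next (sym i≡)) next-i≡)
      where
      i≡ = L-injective i (next i₀) (trans a′ (sym b)) (≤-reflexive a′)
      next-i≡ = L-injective (next i) i₀ (trans b′ (sym a)) (≤-trans (≤-reflexive b′) (n≤1+n 3))

    -- Crossing 3 − 4 changes the potential by 5 + j, and the other 4 + j steps cannot make up for it.
    no-step₃₄ : ∀ i₀ → ¬ Step₃₄ (L i₀) (L (next i₀))
    no-step₃₄ i₀ s₀@(inj₁ (L≡4 , L′≡3)) =
      1+n≰n (sum-spike-≤ (potential ∘ L ∘ next) (potential ∘ L) i₀ (sum-∘next (potential ∘ L))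
                         (subst₂ (λ a b → potential b + (5 + j) ≤ potential a) (sym L≡4) (sym L′≡3) ≤-refl)
                         (λ i i≢i₀ → proj₁ (potential-1-Lipschitz (step i) (step₃₄-unique i₀ s₀ i i≢i₀))))
    no-step₃₄ i₀ s₀@(inj₂ (L≡3 , L′≡4)) =
      1+n≰n (sum-spike-≤ (potential ∘ L) (potential ∘ L ∘ next) i₀ (sym (sum-∘next (potential ∘ L)))
                         (subst₂ (λ a b → potential a + (5 + j) ≤ potential b) (sym L≡3) (sym L′≡4) ≤-refl)
                         (λ i i≢i₀ → proj₂ (potential-1-Lipschitz (step i) (step₃₄-unique i₀ s₀ i i≢i₀))))

    changes : (ℕ → Bool) → Fin (5 + j) → ℕ
    changes χ i = indicator (χ (L i) xor χ (L (next i)))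

    constant-colouring-impossible : (χ : ℕ → Bool) → χ 1 ≡ false → (∀ a → χ a ≡ false → a ≤ 3) →
                                    sum (changes χ) ≡ 0 → ⊥
    constant-colouring-impossible χ χ₁ χ-low no-change = by-colour (χ (L fzero)) refl
      where
      constant : ∀ i → χ (L i) ≡ χ (L fzero)
      constant = constant-along-next (χ ∘ L) (λ i → indicator-xor≡0 (sum≡0⇒≡0 (changes χ) no-change i))
      by-colour : ∀ c → χ (L fzero) ≡ c → ⊥
      by-colour true  χ₀ =
        visits-level-1 λ i L≡1 → true≢false (trans (sym (trans (constant i) χ₀)) (trans (cong χ L≡1) χ₁))
      by-colour false χ₀ = not-within-levels≤3 λ i → χ-low (L i) (trans (constant i) χ₀)

    level-0-once : sum (λ i → indicator (L i ≡ᵇ 0)) ≤ 1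
    level-0-once = sum-indicator-≤1 (λ i → L i ≡ᵇ 0) λ i i′ p p′ →
      L-injective i i′ (trans (≡ᵇ-true⇒≡ p) (sym (≡ᵇ-true⇒≡ p′))) (≤-trans (≤-reflexive (≡ᵇ-true⇒≡ p)) z≤n)

    changes≤2 : sum (changes aboveThree) + sum (changes zeroOrAboveThree) ≤ 2
    changes≤2 = begin
      sum (changes aboveThree) + sum (changes zeroOrAboveThree)
        ≡⟨ ∑-distrib-+ (changes aboveThree) (changes zeroOrAboveThree) ⟨
      sum (λ i → changes aboveThree i + changes zeroOrAboveThree i)
        ≤⟨ sum-mono-≤ (λ i → colour-changes-≤-visits₀ (step i) (no-step₃₄ i)) ⟩
      sum (λ i → at₀ i + at₀ (next i))
        ≡⟨ ∑-distrib-+ at₀ (at₀ ∘ next) ⟩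
      sum at₀ + sum (at₀ ∘ next)
        ≡⟨ cong (sum at₀ +_) (sum-∘next at₀) ⟩
      sum at₀ + sum at₀
        ≤⟨ +-mono-≤ level-0-once level-0-once ⟩
      2 ∎
      where
      open ≤-Reasoning
      at₀ : Fin (5 + j) → ℕ
      at₀ i = indicator (L i ≡ᵇ 0)

    -- Both colourings change colour an even number of times, and at most twice together, so one of them
    -- is constant.
    impossible : ⊥
    impossible =
      [ constant-colouring-impossible aboveThree refl aboveThree-false⇒≤3
      , constant-colouring-impossible zeroOrAboveThree refl zeroOrAboveThree-false⇒≤3
      ]′ (even+even≤2 (colour-changes-even (aboveThree ∘ L)) (colour-changes-even (zeroOrAboveThree ∘ L)) changes≤2)

  G-cycleFree : CycleFree G (5 + j)
  G-cycleFree (f , f-inj , f-adj) = ShortCycle.impossible f f-inj f-adj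

-- More k-cycles than the blow-up

-- The new k-cycle visits the parts in order, except for parts 4 + j and 5 + j (levels 2 and 1), which it
-- visits in swapped order.
module NewCycle (j n : ℕ) (k≤n : 7 + j ≤ n) where
  open Construction j n

  route : ℕ → ℕ
  route a = if a ≡ᵇ 4 + j then 5 + j else if a ≡ᵇ 5 + j then 4 + j else a

  data RouteView (a : ℕ) : Set where
    swapped₄ : a ≡ 4 + j → route a ≡ 5 + j → RouteView a
    swapped₅ : a ≡ 5 + j → route a ≡ 4 + j → RouteView a
    fixed    : a ≢ 4 + j → a ≢ 5 + j → route a ≡ a → RouteView a

  route-4 : route (4 + j) ≡ 5 + j
  route-4 = cong (λ b → if b then 5 + j else (if 4 + j ≡ᵇ 5 + j then 4 + j else 4 + j)) (≡ᵇ-refl (4 + j))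

  route-5 : route (5 + j) ≡ 4 + j
  route-5 = trans (cong (λ b → if b then 5 + j else (if 5 + j ≡ᵇ 5 + j then 4 + j else 5 + j))
                        (≢⇒≡ᵇ-false {5 + j} {4 + j} 1+n≢n))
                  (cong (λ b → if b then 4 + j else 5 + j) (≡ᵇ-refl (5 + j)))

  route-fixed : ∀ a → a ≢ 4 + j → a ≢ 5 + j → route a ≡ a
  route-fixed a a≢4 a≢5 rewrite ≢⇒≡ᵇ-false a≢4 | ≢⇒≡ᵇ-false a≢5 = refl

  routeView : ∀ a → RouteView a
  routeView a with a ℕ.≟ 4 + j | a ℕ.≟ 5 + j
  ... | yes refl | _        = swapped₄ refl route-4
  ... | no _     | yes refl = swapped₅ refl route-5
  ... | no a≢4   | no a≢5   = fixed a≢4 a≢5 (route-fixed a a≢4 a≢5)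

  route<k : ∀ a → a < k → route a < k
  route<k a a<k with routeView a
  ... | swapped₄ _ r = subst (_< k) (sym r) (s≤s (m≤n+m (5 + j) 1))
  ... | swapped₅ _ r = subst (_< k) (sym r) (s≤s (m≤n+m (4 + j) 2))
  ... | fixed _ _ r  = subst (_< k) (sym r) a<k

  route-injective : ∀ a b → route a ≡ route b → a ≡ b
  route-injective a b eq with routeView a | routeView b
  ... | swapped₄ a≡ _    | swapped₄ b≡ _    = trans a≡ (sym b≡)
  ... | swapped₅ a≡ _    | swapped₅ b≡ _    = trans a≡ (sym b≡)
  ... | swapped₄ _ ra    | swapped₅ _ rb    = ⊥-elim (1+n≢n (trans (sym ra) (trans eq rb)))
  ... | swapped₅ _ ra    | swapped₄ _ rb    = ⊥-elim (1+n≢n (trans (sym rb) (trans (sym eq) ra)))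
  ... | swapped₄ _ ra    | fixed _ b≢5 rb   = ⊥-elim (b≢5 (trans (sym rb) (trans (sym eq) ra)))
  ... | swapped₅ _ ra    | fixed b≢4 _ rb   = ⊥-elim (b≢4 (trans (sym rb) (trans (sym eq) ra)))
  ... | fixed _ a≢5 ra   | swapped₄ _ rb    = ⊥-elim (a≢5 (trans (sym ra) (trans eq rb)))
  ... | fixed a≢4 _ ra   | swapped₅ _ rb    = ⊥-elim (a≢4 (trans (sym ra) (trans eq rb)))
  ... | fixed _ _ ra     | fixed _ _ rb     = trans (sym ra) (trans eq rb)

  cycle : Fin k → Fin n
  cycle i = Fin.inject≤ (fromℕ< (route<k (toℕ i) (Finₚ.toℕ<n i))) k≤n

  toℕ-cycle : ∀ i → toℕ (cycle i) ≡ route (toℕ i)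
  toℕ-cycle i = trans (Finₚ.toℕ-inject≤ _ k≤n) (Finₚ.toℕ-fromℕ< _)

  part-cycle : ∀ i → part k (cycle i) ≡ route (toℕ i)
  part-cycle i = trans (cong (_% k) (toℕ-cycle i)) (m<n⇒m%n≡m (route<k (toℕ i) (Finₚ.toℕ<n i)))

  cycle-injective : Injective _≡_ _≡_ cycle
  cycle-injective {i} {i′} eq =
    Finₚ.toℕ-injective (route-injective _ _ (trans (sym (toℕ-cycle i)) (trans (cong toℕ eq) (toℕ-cycle i′))))

  data PositionView (a : ℕ) : Set where
    early : a < 3 + j → PositionView a
    at₃   : a ≡ 3 + j → PositionView a
    at₄   : a ≡ 4 + j → PositionView a
    at₅   : a ≡ 5 + j → PositionView a
    at₆   : a ≡ 6 + j → PositionView a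

  positionView : ∀ a → a < k → PositionView a
  positionView a a<k with a ℕ.<? 3 + j
  ... | yes a<3 = early a<3
  ... | no a≮3 with a ℕ.≟ 3 + j
  ...   | yes a≡3 = at₃ a≡3
  ...   | no a≢3 with a ℕ.≟ 4 + j
  ...     | yes a≡4 = at₄ a≡4
  ...     | no a≢4 with a ℕ.≟ 5 + j
  ...       | yes a≡5 = at₅ a≡5
  ...       | no a≢5 = at₆ (≤-antisym (≤-pred a<k) 5<a)
    where
    5<a : 5 + j < a
    5<a = ≤∧≢⇒< (≤∧≢⇒< (≤∧≢⇒< (≮⇒≥ a≮3) (a≢3 ∘ sym)) (a≢4 ∘ sym)) (a≢5 ∘ sym)

  toℕ-next-early : ∀ (i : Fin k) → toℕ i < 6 + j → toℕ (next i) ≡ suc (toℕ i)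
  toℕ-next-early i i<6 with toℕ-next i
  ... | inj₁ (eq , _) = eq
  ... | inj₂ (_ , eq) = ⊥-elim (<-irrefl (suc-injective eq) i<6)

  toℕ-next-last : ∀ (i : Fin k) → toℕ i ≡ 6 + j → toℕ (next i) ≡ 0
  toℕ-next-last i i≡6 with toℕ-next i
  ... | inj₁ (_ , i+1<k) = ⊥-elim (<-irrefl (cong suc i≡6) i+1<k)
  ... | inj₂ (eq , _)    = eq

  route-below : ∀ {a} → a < 4 + j → route a ≡ a
  route-below {a} a<4 = route-fixed a (λ e → <-irrefl e a<4) (λ e → <-irrefl e (<-trans a<4 (n<1+n _)))

  route-6 : route (6 + j) ≡ 6 + j
  route-6 = route-fixed (6 + j) (λ ()) (λ ())

  part-cycle-at : ∀ i {a} → toℕ i ≡ a → part k (cycle i) ≡ route a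
  part-cycle-at i eq = trans (part-cycle i) (cong route eq)

  Gadj-next-part : ∀ u v → suc (part k u) % k ≡ part k v → Gadj u v ≡ true
  Gadj-next-part u v eq = cong (λ b → (b ∨ (suc (part k v) % k ≡ᵇ part k u)) ∨ chord u v)
                               (trans (cong (_≡ᵇ part k v) eq) (≡ᵇ-refl (part k v)))

  Gadj-chord : ∀ u v → chordᵇ (level u) (level v) ≡ true → Gadj u v ≡ true
  Gadj-chord u v c = trans (cong (λ b → blowup u v ∨ (b ∨ chordᵇ (level v) (level u))) c) (∨-zeroʳ _)

  toℕ-next-at : ∀ (i : Fin k) {a} → toℕ i ≡ a → a < 6 + j → toℕ (next i) ≡ suc a
  toℕ-next-at i refl a<6 = toℕ-next-early i a<6

  cycle-adj : ∀ i → Gadj (cycle i) (cycle (next i)) ≡ true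
  cycle-adj i with positionView (toℕ i) (Finₚ.toℕ<n i)
  ... | early i<3 = Gadj-next-part (cycle i) (cycle (next i)) (begin
    suc (part k (cycle i)) % k  ≡⟨ cong (λ p → suc p % k) (trans (part-cycle i) (route-below (<-trans i<3 (n<1+n _)))) ⟩
    suc (toℕ i) % k             ≡⟨ m<n⇒m%n≡m (s≤s i<6) ⟩
    suc (toℕ i)                 ≡⟨ route-below (s≤s i<3) ⟨
    route (suc (toℕ i))         ≡⟨ part-cycle-at (next i) (toℕ-next-early i i<6) ⟨
    part k (cycle (next i))     ∎)
    where
    open ≡-Reasoning
    i<6 : toℕ i < 6 + j
    i<6 = ≤-trans i<3 (m≤n+m (3 + j) 3)
  ... | at₃ i≡3 = Gadj-chord (cycle i) (cycle (next i)) (cong₂ chordᵇ level₃ level₁)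
    where
    level₃ : level (cycle i) ≡ 3
    level₃ = trans (cong (6 + j ∸_) (trans (part-cycle-at i i≡3) (route-below (n<1+n _)))) (m+n∸n≡m 3 j)
    level₁ : level (cycle (next i)) ≡ 1
    level₁ = trans (cong (6 + j ∸_) (trans (part-cycle-at (next i) (toℕ-next-at i i≡3 (m≤n+m (4 + j) 2))) route-4))
                   (m+n∸n≡m 1 j)
  ... | at₄ i≡4 = trans (Gadj-sym (cycle i) (cycle (next i))) (Gadj-next-part (cycle (next i)) (cycle i) (begin
    suc (part k (cycle (next i))) % k  ≡⟨ cong (λ p → suc p % k) (trans (part-cycle-at (next i) next≡5) route-5) ⟩
    (5 + j) % k                        ≡⟨ m<n⇒m%n≡m (m≤n+m (6 + j) 1) ⟩
    5 + j                              ≡⟨ trans (part-cycle-at i i≡4) route-4 ⟨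
    part k (cycle i)                   ∎))
    where
    open ≡-Reasoning
    next≡5 = toℕ-next-at i i≡4 (m≤n+m (5 + j) 1)
  ... | at₅ i≡5 = Gadj-chord (cycle i) (cycle (next i)) (cong₂ chordᵇ level₂ level₀)
    where
    level₂ : level (cycle i) ≡ 2
    level₂ = trans (cong (6 + j ∸_) (trans (part-cycle-at i i≡5) route-5)) (m+n∸n≡m 2 j)
    level₀ : level (cycle (next i)) ≡ 0
    level₀ = trans (cong (6 + j ∸_) (trans (part-cycle-at (next i) (toℕ-next-at i i≡5 ≤-refl)) route-6))
                   (n∸n≡0 (6 + j))
  ... | at₆ i≡6 = Gadj-next-part (cycle i) (cycle (next i)) (begin
    suc (part k (cycle i)) % k  ≡⟨ cong (λ p → suc p % k) (trans (part-cycle-at i i≡6) route-6) ⟩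
    k % k                       ≡⟨ n%n≡0 k ⟩
    0                           ≡⟨ route-below (s≤s z≤n) ⟨
    route 0                     ≡⟨ part-cycle-at (next i) (toℕ-next-last i i≡6) ⟨
    part k (cycle (next i))     ∎)
    where open ≡-Reasoning

  position₃ : Fin k
  position₃ = fromℕ< {3 + j} (m≤n+m (4 + j) 3)

  cycle-misses-blowup-edge : MissesEdge blowup cycle
  cycle-misses-blowup-edge = position₃ , cong₂ _∨_
    (trans (cong₂ _≡ᵇ_ (trans (cong (λ p → suc p % k) part₃) (m<n⇒m%n≡m (m≤n+m (5 + j) 2))) part₅) (≢⇒≡ᵇ-false {4 + j} {5 + j} (λ ())))
    (trans (cong₂ _≡ᵇ_ (trans (cong (λ p → suc p % k) part₅) (m<n⇒m%n≡m (n<1+n (6 + j)))) part₃) (≢⇒≡ᵇ-false {6 + j} {3 + j} (λ ())))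
    where
    position₃≡ : toℕ position₃ ≡ 3 + j
    position₃≡ = Finₚ.toℕ-fromℕ< (m≤n+m (4 + j) 3)
    part₃ : part k (cycle position₃) ≡ 3 + j
    part₃ = trans (part-cycle-at position₃ position₃≡) (route-below (n<1+n _))
    part₅ : part k (cycle (next position₃)) ≡ 5 + j
    part₅ = trans (part-cycle-at (next position₃) (toℕ-next-at position₃ position₃≡ (m≤n+m (4 + j) 2))) route-4

  New : (Fin k → Fin n) → Set
  New f = CycleMap Gadj f × MissesEdge blowup f

  New-cycle : New cycle
  New-cycle = (cycle-injective , cycle-adj) , cycle-misses-blowup-edge

  relabelling : Fin k ⊎ Fin k → Fin k → Fin n
  relabelling x = cycle ∘ dihedral x

  New-relabelling : ∀ x → New (relabelling x)
  New-relabelling x = ∘dihedral-closed New New-∘next New-∘opposite x New-cycle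
    where
    New-∘next : ∀ {f} → New f → New (f ∘ next)
    New-∘next {f} (cyc , miss) = CycleMap-∘next {A = Gadj} {f} cyc , MissesEdge-∘next {A = blowup} {f} miss
    New-∘opposite : ∀ {f} → New f → New (f ∘ Fin.opposite)
    New-∘opposite {f} (cyc , miss) =
      CycleMap-∘opposite {A = Gadj} {f} Gadj-sym cyc , MissesEdge-∘opposite {A = blowup} {f} blowupAdj-sym miss

  relabelling-injective : ∀ {x y} → relabelling x ≗ relabelling y → x ≡ y
  relabelling-injective eq = dihedral-injective (cycle-injective ∘ eq)

  newᵇ : (Fin k → Fin n) → Bool
  newᵇ f = isCycleMapᵇ Gadj f ∧ not (isCycleMapᵇ blowup f)

  New⇒newᵇ : ∀ {f} → New f → newᵇ f ≡ true
  New⇒newᵇ {f} (cyc , miss) =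
    cong₂ (λ a b → a ∧ not b) (isCycleMapᵇ-complete Gadj f cyc) (MissesEdge⇒isCycleMapᵇ-false {A = blowup} {f} miss)

  2k≤new-labelled : k + k ≤ length (filterᵇ newᵇ (allFuns k n))
  2k≤new-labelled = distinct-maps-≤ newᵇ (relabelling ∘ Fin.splitAt k) splitAt-injective
    λ x h h≗ → New⇒newᵇ (New-≗ (sym ∘ h≗) (New-relabelling (Fin.splitAt k x)))
    where
    New-≗ : ∀ {f g} → f ≗ g → New f → New g
    New-≗ f≗g (cyc , miss) = CycleMap-≗ {A = Gadj} f≗g cyc , MissesEdge-≗ {A = blowup} f≗g miss
    splitAt-injective : ∀ {x y} → relabelling (Fin.splitAt k x) ≗ relabelling (Fin.splitAt k y) → x ≡ y
    splitAt-injective {x} {y} eq = trans (sym (Finₚ.join-splitAt k k x))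
      (trans (cong (Fin.join k k) (relabelling-injective {Fin.splitAt k x} {Fin.splitAt k y} eq)) (Finₚ.join-splitAt k k y))

  blowup⊆G : ∀ u v → blowup u v ≡ true → Gadj u v ≡ true
  blowup⊆G u v uv = cong (_∨ chord u v) uv

  labelled-cycles : labelledCycles blowup k + 2 * k ≤ labelledCycles Gadj k
  labelled-cycles = begin
    labelledCycles blowup k + 2 * k
      ≡⟨ cong (λ x → labelledCycles blowup k + (k + x)) (+-identityʳ k) ⟩
    labelledCycles blowup k + (k + k)
      ≤⟨ +-monoʳ-≤ (labelledCycles blowup k) 2k≤new-labelled ⟩
    labelledCycles blowup k + length (filterᵇ newᵇ (allFuns k n))
      ≡⟨ length-filterᵇ-split (isCycleMapᵇ blowup) (isCycleMapᵇ Gadj) B⇒G (allFuns k n) ⟩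
    labelledCycles Gadj k ∎
    where
    open ≤-Reasoning
    B⇒G : ∀ f → isCycleMapᵇ blowup f ≡ true → isCycleMapᵇ Gadj f ≡ true
    B⇒G f cyc = isCycleMapᵇ-complete Gadj f (CycleMap-mono blowup⊆G (isCycleMapᵇ-sound blowup f cyc))

proposition3p1 : (k n : ℕ) → 7 ≤ k → ¬ (2 ∣ k) → k ≤ n → 2 * n ≤ 3 * (k ∸ 1) →
    Σ (Graph n) (λ G → CycleFree G (k ∸ 2) × blowupCycles k n < numCycles G k)
proposition3p1 k n 7≤k k-odd k≤n 2n≤3[k-1] with m≤n⇒∃[o]m+o≡n 7≤k
... | j , refl = G , CycleFreeness.G-cycleFree j n n≤ j-even , more-k-cycles
  where
  open Construction j n hiding (k)
  more-k-cycles : blowupCycles (7 + j) n < numCycles G (7 + j)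
  more-k-cycles = m+o≤n⇒m/o<n/o {o = 2 * (7 + j)} (NewCycle.labelled-cycles j n k≤n)
  j-even : 2 ∣ j
  j-even = ∣m+n∣m⇒∣n (odd⇒pred-even (6 + j) k-odd) (divides 3 refl)
  n≤ : n ≤ 9 + 2 * j
  n≤ = *-cancelˡ-≤ 2 (≤-trans 2n≤3[k-1] (≤-trans (m≤m+n (3 * (6 + j)) j) (≤-reflexive (bound j))))
    where
    bound : ∀ j → 3 * (6 + j) + j ≡ 2 * (9 + 2 * j)
    bound = solve-∀
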